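{- In the setting described in the context, for every $F':\mathcal V'\to\{0,1\}$, \[ \mathrm{val}_{\mathcal P'}(F')\ \ge\ \mathbb E_{A\in V^R}\,\mathrm{val}_{\mu_H^R}(g_A), \] where $A$ is uniform in $V^R$.
   Context: Let $G=(V,E)$ be a finite regular graph, $\mu_V$ uniform on $V$. Parameters: $\epsilon\in(0,1/3]$, an integer $d\ge1$, a positive integer $R$, $\eta=\epsilon/(100d)$. A step of $G_\eta$ from $a\in V$: with probability $1-\eta$ move to a uniformly random $G$-neighbour of $a$, with probability $\eta$ to a uniformly random vertex of $V$; for $A\in V^R$, $B\sim G_\eta^{\otimes R}(A)$ means $b_i\sim G_\eta(a_i)$ independently. $H$ is the Markov chain on $V_H=\{s,t,t',s'\}$ with $p(s|s)=p(s'|s')=1-\frac{\epsilon}{1-2\epsilon}$, $p(t|s)=p(t'|s')=\frac{\epsilon}{1-2\epsilon}$, $p(s|t)=p(s'|t')=p(t'|t)=p(t|t')=\frac12$, stationary distribution $\mu_H(s)=\mu_H(s')=\frac12-\epsilon$, $\mu_H(t)=\mu_H(t')=\epsilon$; $y\sim H^R(x)$ is one step of the product chain from $x\in V_H^R$ (coordinates move independently). $\mathcal V=(V\times V_H)^R$, $\mu=(\mu_V\times\mu_H)^{\otimes R}$; $\mathcal P$ on $\mathcal V^{d+1}$: $A$ uniform in $V^R$; $B,C_1,\dots,C_d$ independent $\sim G_\eta^{\otimes R}(A)$; $x\sim\mu_H^{\otimes R}$; $y_1,\dots,y_d$ independent $\sim H^R(x)$; output $((B,x),(C_1,y_1),\dots,(C_d,y_d))$.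 $\Pi((a_1,x_1),\dots,(a_R,x_R))$ is the multiset $\{(a_i,x_i):x_i\in\{s,t\}\}$; $\mathcal V'$ is the set of multisets of elements of $V\times\{s,t\}$ with at most $R$ elements; $\mathcal P'$ is the pushforward of $\mathcal P$ under $\Pi$ applied coordinatewise. $\mathrm{val}_{\mathcal P'}(F')=\mathbb E_{(X,Y_1,\dots,Y_d)\sim\mathcal P'}\max_i|F'(X)-F'(Y_i)|$. Define $F(A,x)=F'(\Pi(A,x))$ and $g_A(x)=\mathbb E_{B\sim G_\eta^{\otimes R}(A)}F(B,x)$ for $A\in V^R$, $x\in V_H^R$. For $g:V_H^R\to[0,1]$, $\mathrm{val}_{\mu_H^R}(g)=\mathbb E_{x\sim\mu_H^{\otimes R}}\mathbb E_{y_1,\dots,y_d\sim H^R(x)}\max_i|g(x)-g(y_i)|$ with $y_i$ independent. -}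

module Defs where

open import Data.Nat as ℕ using (ℕ; zero; suc)
open import Data.Fin using (Fin; zero; suc)
open import Data.Vec using (Vec; []; _∷_; lookup; tabulate; replicate)
open import Data.Bool using (Bool; true; false; if_then_else_)
open import Data.Integer using (+_)
open import Data.Rational using (ℚ; 0ℚ; 1ℚ; _+_; _*_; _-_; _÷_; ∣_∣; _⊔_; _/_; ≢-nonZero)
open import Data.Rational.Properties using (_≟_)
open import Relation.Nullary using (yes; no)
open import Relation.Binary.PropositionalEquality using (_≡_)

ℕ→ℚ : ℕ → ℚ
ℕ→ℚ n = + n / 1

-- total division on ℚ (division by 0 returns 0; it is only ever used
-- with nonzero denominators under the hypotheses of the statement)
_÷?_ : ℚ → ℚ → ℚ
p ÷? q with q ≟ 0ℚ
... | yes _ = 0ℚ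
... | no q≢0 = _÷_ p q {{≢-nonZero q≢0}}

infixl 7 _÷?_

bool→ℚ : Bool → ℚ
bool→ℚ true  = 1ℚ
bool→ℚ false = 0ℚ

sumFin : (n : ℕ) → (Fin n → ℚ) → ℚ
sumFin zero    f = 0ℚ
sumFin (suc n) f = f zero + sumFin n (λ i → f (suc i))

countFin : (n : ℕ) → (Fin n → Bool) → ℕ
countFin zero    p = 0
countFin (suc n) p = (if p zero then 1 else 0) ℕ.+ countFin n (λ i → p (suc i))

sumVec : (m R : ℕ) → (Vec (Fin m) R → ℚ) → ℚ
sumVec m zero    f = f []
sumVec m (suc R) f = sumFin m (λ a → sumVec m R (λ as → f (a ∷ as)))

-- maximum of a vector of nonnegative rationals (0 for the empty vector)
maxVec : {d : ℕ} → Vec ℚ d → ℚ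
maxVec []       = 0ℚ
maxVec (q ∷ qs) = q ⊔ maxVec qs

Dist : ℕ → Set
Dist m = Fin m → ℚ

Kernel : ℕ → Set
Kernel m = Fin m → Fin m → ℚ     -- K a b = probability of moving from a to b

prodDist : {m R : ℕ} → Dist m → Vec (Fin m) R → ℚ
prodDist μ []       = 1ℚ
prodDist μ (a ∷ as) = μ a * prodDist μ as

prodKernel : {m R : ℕ} → Kernel m → Vec (Fin m) R → Vec (Fin m) R → ℚ
prodKernel K []       []       = 1ℚ
prodKernel K (a ∷ as) (b ∷ bs) = K a b * prodKernel K as bs

E-prod : (m R : ℕ) → Dist m → (Vec (Fin m) R → ℚ) → ℚ
E-prod m R μ f = sumVec m R (λ x → prodDist μ x * f x)

E-step : (m R : ℕ) → Kernel m → Vec (Fin m) R → (Vec (Fin m) R → ℚ) → ℚ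
E-step m R K A f = sumVec m R (λ B → prodKernel K A B * f B)

E-steps : (m R d : ℕ) → Kernel m → Vec (Fin m) R → (Vec (Vec (Fin m) R) d → ℚ) → ℚ
E-steps m R zero    K A f = f []
E-steps m R (suc d) K A f = E-step m R K A (λ C → E-steps m R d K A (λ Cs → f (C ∷ Cs)))

degree : (n : ℕ) → (Fin n → Fin n → Bool) → Fin n → ℕ
degree n adj a = countFin n (adj a)

record IsRegularGraph (n k : ℕ) (adj : Fin n → Fin n → Bool) : Set where
  field
    symm    : ∀ a b → adj a b ≡ adj b a
    noLoops : ∀ a → adj a a ≡ false
    regular : ∀ a → degree n adj a ≡ k

uniform : (n : ℕ) → Dist n
uniform n _ = 1ℚ ÷? ℕ→ℚ n

etaOf : ℚ → ℕ → ℚ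
etaOf ε d = ε ÷? ℕ→ℚ (100 ℕ.* d)

Gη : (n k : ℕ) → (Fin n → Fin n → Bool) → ℚ → Kernel n
Gη n k adj η a b =
  (1ℚ - η) * (bool→ℚ (adj a b) ÷? ℕ→ℚ k) + η * uniform n b

VH : Set
VH = Fin 4

sH tH t'H s'H : VH
sH  = zero
tH  = suc zero
t'H = suc (suc zero)
s'H = suc (suc (suc zero))

half : ℚ
half = + 1 / 2

H : ℚ → Kernel 4
H ε zero                   zero                   = 1ℚ - ε ÷? (1ℚ - ℕ→ℚ 2 * ε)
H ε zero                   (suc zero)             = ε ÷? (1ℚ - ℕ→ℚ 2 * ε)
H ε zero                   (suc (suc _))          = 0ℚ
H ε (suc zero)             zero                   = half
H ε (suc zero)             (suc zero)             = 0ℚ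
H ε (suc zero)             (suc (suc zero))       = half
H ε (suc zero)             (suc (suc (suc _)))    = 0ℚ
H ε (suc (suc zero))       (suc zero)             = half
H ε (suc (suc zero))       (suc (suc (suc zero))) = half
H ε (suc (suc zero))       _                      = 0ℚ
H ε (suc (suc (suc zero))) (suc (suc (suc zero))) = 1ℚ - ε ÷? (1ℚ - ℕ→ℚ 2 * ε)
H ε (suc (suc (suc zero))) (suc (suc zero))       = ε ÷? (1ℚ - ℕ→ℚ 2 * ε)
H ε (suc (suc (suc zero))) _                      = 0ℚ

μH : ℚ → Dist 4
μH ε zero                   = half - ε
μH ε (suc zero)             = ε
μH ε (suc (suc zero))       = ε
μH ε (suc (suc (suc zero))) = half - ε

-- Multisets over V × {s,t} are represented by their multiplicity vectors
-- Vec (Vec ℕ 2) n : entry [a][0] = multiplicity of (a,s),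
--                   entry [a][1] = multiplicity of (a,t).
-- V' (multisets with at most R elements) is contained in this type; a
-- function F' : V' → {0,1} is thus given by a function on multiplicity
-- vectors (only its values on Π's image matter).

Multiset : ℕ → Set
Multiset n = Vec (Vec ℕ 2) n

-- Π(A,x) = multiset {(a_i,x_i) : x_i ∈ {s,t}}
Π : {n R : ℕ} → Vec (Fin n) R → Vec VH R → Multiset n
Π []       []       = replicate _ (replicate _ 0)
Π {n} (a ∷ as) (x ∷ xs) = tabulate λ v → tabulate λ u → addIf v u x (lookup (lookup (Π as xs) v) u)
  where
  open import Data.Fin.Properties using () renaming (_≟_ to _≟F_)
  addIf : Fin n → Fin 2 → VH → ℕ → ℕ
  addIf v zero       zero       c with v ≟F a
  ... | yes _ = suc c
  ... | no  _ = c
  addIf v (suc zero) (suc zero) c with v ≟F a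
  ... | yes _ = suc c
  ... | no  _ = c
  addIf v _ _ c = c

module Setting (n k : ℕ) (adj : Fin n → Fin n → Bool) (ε : ℚ) (d R : ℕ) where

  η : ℚ
  η = etaOf ε d

  G : Kernel n
  G = Gη n k adj η

  Fof : (Multiset n → Bool) → Vec (Fin n) R → Vec VH R → ℚ
  Fof F' A x = bool→ℚ (F' (Π A x))

  valP' : (Multiset n → Bool) → ℚ
  valP' F' =
    E-prod n R (uniform n) λ A →
    E-step n R G A λ B →
    E-steps n R d G A λ Cs →
    E-prod 4 R (μH ε) λ x →
    E-steps 4 R d (H ε) x λ ys →
    maxVec (Data.Vec.zipWith (λ C y → ∣ Fof F' B x - Fof F' C y ∣) Cs ys)

  gA : (Multiset n → Bool) → Vec (Fin n) R → Vec VH R → ℚ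
  gA F' A x = E-step n R G A (λ B → Fof F' B x)

  valμH : (Vec VH R → ℚ) → ℚ
  valμH g =
    E-prod 4 R (μH ε) λ x →
    E-steps 4 R d (H ε) x λ ys →
    maxVec (Data.Vec.map (λ y → ∣ g x - g y ∣) ys)

module Submission where

-- For fixed A, write g = g_A. For each x and each y_i, the difference g(x) - g(y_i) is the
-- average of F(B,x) - F(C_i,y_i) over B, C_i drawn independently from G_η^{⊗R}(A); by the
-- triangle inequality for averages, and since a maximum of averages is at most the average of
-- the maximum, max_i |g(x) - g(y_i)| is at most the average over B, C_1, …, C_d of
-- max_i |F(B,x) - F(C_i,y_i)|. Averaging over x, y and A and exchanging the finite sums
-- (Fubini) gives exactly val_{P'}(F').

open import Defs
open import Data.Nat as ℕ using (ℕ; zero; suc; _≥_)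
open import Data.Fin using (Fin; zero; suc)
open import Data.Bool using (Bool; true; false)
open import Data.Vec using (Vec; []; _∷_; map; zipWith)
open import Data.Integer using (+_)
open import Data.Rational
  using (ℚ; 0ℚ; 1ℚ; _+_; _*_; _-_; -_; ∣_∣; _/_; 1/_; _≤_; _<_; _≤?_;
         NonZero; nonNegative; ≢-nonZero; toℚᵘ)
open import Data.Rational.Properties
import Data.Nat.Properties as ℕ
import Data.Integer.Properties as ℤ
import Data.Rational.Unnormalised as ℚᵘ
import Data.Rational.Unnormalised.Properties as ℚᵘ
open import Data.Rational.Solver using (module +-*-Solver)
open import Data.Sum using (inj₁; inj₂)
open import Data.Unit using (tt)
open import Data.Empty using (⊥-elim)
open import Relation.Nullary using (yes; no)
open import Relation.Nullary.Decidable using (toWitness)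
open import Relation.Binary.PropositionalEquality

open +-*-Solver

Functional : Set → Set
Functional T = (T → ℚ) → ℚ

record IsLinear {T : Set} (S : Functional T) : Set where
  field
    ext         : ∀ {f g : T → ℚ} → (∀ t → f t ≡ g t) → S f ≡ S g
    additive    : ∀ (f g : T → ℚ) → S (λ t → f t + g t) ≡ S f + S g
    homogeneous : ∀ c (f : T → ℚ) → S (λ t → c * f t) ≡ c * S f

  zero-hom : S (λ _ → 0ℚ) ≡ 0ℚ
  zero-hom = begin
    S (λ _ → 0ℚ)        ≡⟨ ext (λ _ → sym (*-zeroˡ 0ℚ)) ⟩
    S (λ _ → 0ℚ * 0ℚ)   ≡⟨ homogeneous 0ℚ (λ _ → 0ℚ) ⟩
    0ℚ * S (λ _ → 0ℚ)   ≡⟨ *-zeroˡ (S (λ _ → 0ℚ)) ⟩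
    0ℚ                  ∎
    where open ≡-Reasoning

  neg-hom : ∀ (f : T → ℚ) → S (λ t → - f t) ≡ - S f
  neg-hom f = begin
    S (λ t → - f t)          ≡⟨ ext (λ t → neg≡-1* (f t)) ⟩
    S (λ t → (- 1ℚ) * f t)   ≡⟨ homogeneous (- 1ℚ) f ⟩
    (- 1ℚ) * S f             ≡⟨ sym (neg≡-1* (S f)) ⟩
    - S f                    ∎
    where
    open ≡-Reasoning
    neg≡-1* : ∀ p → - p ≡ (- 1ℚ) * p
    neg≡-1* = solve 1 (λ p → :- p := (:- con 1ℚ) :* p) refl

  sub-hom : ∀ (f g : T → ℚ) → S (λ t → f t - g t) ≡ S f - S g
  sub-hom f g = trans (additive f (λ t → - g t)) (cong (_+_ (S f)) (neg-hom g))

Interchangeable : {T : Set} → Functional T → Set₁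
Interchangeable {T} S = ∀ {U : Set} (S′ : Functional U) → IsLinear S′ → (f : T → U → ℚ) →
  S′ (λ u → S (λ t → f t u)) ≡ S (λ t → S′ (f t))

Monotone : {T : Set} → Functional T → Set
Monotone {T} S = ∀ {f g : T → ℚ} → (∀ t → f t ≤ g t) → S f ≤ S g

Normalised : {T : Set} → Functional T → Set
Normalised S = ∀ c → S (λ _ → c) ≡ c

record IsPositiveLinear {T : Set} (S : Functional T) : Set₁ where
  field
    isLinear    : IsLinear S
    monotone    : Monotone S
    interchange : Interchangeable S

  open IsLinear isLinear public

p≤∣p∣ : ∀ p → p ≤ ∣ p ∣
p≤∣p∣ p with ≤-total 0ℚ p
... | inj₁ 0≤p = ≤-reflexive (sym (0≤p⇒∣p∣≡p 0≤p))
... | inj₂ p≤0 = ≤-trans p≤0 (0≤∣p∣ p)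

module _ {T : Set} {S : Functional T} (P : IsPositiveLinear S) (N : Normalised S) where
  open IsPositiveLinear P

  const≤ : ∀ {c} {f : T → ℚ} → (∀ t → c ≤ f t) → c ≤ S f
  const≤ {c} {f} c≤f = subst (_≤ S f) (N c) (monotone c≤f)

  ∣∣-jensen : ∀ (f : T → ℚ) → ∣ S f ∣ ≤ S (λ t → ∣ f t ∣)
  ∣∣-jensen f with ∣p∣≡p∨∣p∣≡-p (S f)
  ... | inj₁ ∣Sf∣≡Sf  = subst (_≤ S (λ t → ∣ f t ∣)) (sym ∣Sf∣≡Sf) (monotone (λ t → p≤∣p∣ (f t)))
  ... | inj₂ ∣Sf∣≡-Sf = subst (_≤ S (λ t → ∣ f t ∣)) (sym (trans ∣Sf∣≡-Sf (sym (neg-hom f))))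
                              (monotone (λ t → subst (- f t ≤_) (∣-p∣≡∣p∣ (f t)) (p≤∣p∣ (- f t))))

  difference-as-average : ∀ {Y : Set} (F : T → Y → ℚ) x y →
    S (λ b → F b x) - S (λ c → F c y) ≡ S (λ b → S (λ c → F b x - F c y))
  difference-as-average F x y = sym (begin
    S (λ b → S (λ c → F b x - F c y))     ≡⟨ ext (λ b → sub-hom (λ _ → F b x) (λ c → F c y)) ⟩
    S (λ b → S (λ _ → F b x) - gy)        ≡⟨ ext (λ b → cong (_- gy) (N (F b x))) ⟩
    S (λ b → F b x - gy)                  ≡⟨ sub-hom (λ b → F b x) (λ _ → gy) ⟩
    S (λ b → F b x) - S (λ _ → gy)        ≡⟨ cong (_-_ (S (λ b → F b x))) (N gy) ⟩
    S (λ b → F b x) - gy                  ∎)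
    where
    open ≡-Reasoning
    gy : ℚ
    gy = S (λ c → F c y)

interchange₂ : {X B C : Set} {P : Functional X} {S : Functional B} {T : Functional C} →
  Interchangeable P → IsLinear S → IsLinear T → (h : X → B → C → ℚ) →
  P (λ x → S (λ b → T (λ c → h x b c))) ≡ S (λ b → T (λ c → P (λ x → h x b c)))
interchange₂ {S = S} {T = T} P-fubini S-linear T-linear h =
  trans (sym (P-fubini S S-linear (λ x b → T (h x b))))
        (IsLinear.ext S-linear (λ b → sym (P-fubini T T-linear (λ x → h x b))))

0≤*-nonneg : ∀ {p q} → 0ℚ ≤ p → 0ℚ ≤ q → 0ℚ ≤ p * q
0≤*-nonneg {p} {q} 0≤p 0≤q =
  nonNegative⁻¹ _ {{nonNeg*nonNeg⇒nonNeg p {{nonNegative 0≤p}} q {{nonNegative 0≤q}}}}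

sumFin-positive : ∀ m → IsPositiveLinear (sumFin m)
sumFin-positive zero = record
  { isLinear    = record { ext = λ _ → refl ; additive = λ _ _ → refl ; homogeneous = λ c _ → sym (*-zeroʳ c) }
  ; monotone    = λ _ → ≤-refl
  ; interchange = λ S′ S′-linear _ → IsLinear.zero-hom S′-linear
  }
sumFin-positive (suc m) = record
  { isLinear    = record
    { ext         = λ f≗g → cong₂ _+_ (f≗g zero) (ext (λ i → f≗g (suc i)))
    ; additive    = λ f g → trans (cong (_+_ (f zero + g zero)) (additive (λ i → f (suc i)) (λ i → g (suc i))))
                                  (swap-middle (f zero) (g zero) _ _)
    ; homogeneous = λ c f → trans (cong (_+_ (c * f zero)) (homogeneous c _)) (sym (*-distribˡ-+ c _ _))
    }
  ; monotone    = λ f≤g → +-mono-≤ (f≤g zero) (monotone (λ i → f≤g (suc i)))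
  ; interchange = λ S′ S′-linear f →
      trans (IsLinear.additive S′-linear _ _) (cong (_+_ (S′ (f zero))) (interchange S′ S′-linear (λ i → f (suc i))))
  }
  where
  open IsPositiveLinear (sumFin-positive m)
  swap-middle : ∀ a b c d → (a + b) + (c + d) ≡ (a + c) + (b + d)
  swap-middle = solve 4 (λ a b c d → (a :+ b) :+ (c :+ d) := (a :+ c) :+ (b :+ d)) refl

-- sumVec and E-steps unfold definitionally into nilᶠ and _∷ᶠ_, and E-prod, E-step into
-- weighted sumVec, so their properties follow from the closure lemmas below.
nilᶠ : {T : Set} → Functional (Vec T 0)
nilᶠ f = f []

_∷ᶠ_ : {T : Set} {d : ℕ} → Functional T → Functional (Vec T d) → Functional (Vec T (suc d))
(S₁ ∷ᶠ S₂) f = S₁ (λ a → S₂ (λ as → f (a ∷ as)))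

nilᶠ-positive : {T : Set} → IsPositiveLinear (nilᶠ {T})
nilᶠ-positive = record
  { isLinear    = record { ext = λ f≗g → f≗g [] ; additive = λ _ _ → refl ; homogeneous = λ _ _ → refl }
  ; monotone    = λ f≤g → f≤g []
  ; interchange = λ _ _ _ → refl
  }

∷ᶠ-positive : {T : Set} {d : ℕ} {S₁ : Functional T} {S₂ : Functional (Vec T d)} →
  IsPositiveLinear S₁ → IsPositiveLinear S₂ → IsPositiveLinear (S₁ ∷ᶠ S₂)
∷ᶠ-positive P₁ P₂ = record
  { isLinear    = record
    { ext         = λ f≗g → P₁.ext (λ a → P₂.ext (λ as → f≗g (a ∷ as)))
    ; additive    = λ f g → trans (P₁.ext (λ a → P₂.additive _ _)) (P₁.additive _ _)
    ; homogeneous = λ c f → trans (P₁.ext (λ a → P₂.homogeneous c _)) (P₁.homogeneous c _)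
    }
  ; monotone    = λ f≤g → P₁.monotone (λ a → P₂.monotone (λ as → f≤g (a ∷ as)))
  ; interchange = λ S′ S′-linear f →
      trans (P₁.interchange S′ S′-linear _) (P₁.ext (λ a → P₂.interchange S′ S′-linear (λ as → f (a ∷ as))))
  }
  where
  module P₁ = IsPositiveLinear P₁
  module P₂ = IsPositiveLinear P₂

∷ᶠ-normalised : {T : Set} {d : ℕ} {S₁ : Functional T} {S₂ : Functional (Vec T d)} →
  IsLinear S₁ → Normalised S₁ → Normalised S₂ → Normalised (S₁ ∷ᶠ S₂)
∷ᶠ-normalised L₁ N₁ N₂ c = trans (IsLinear.ext L₁ (λ _ → N₂ c)) (N₁ c)

weighted : {T : Set} → Functional T → (T → ℚ) → Functional T
weighted S w f = S (λ t → w t * f t)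

weighted-positive : {T : Set} {S : Functional T} → IsPositiveLinear S →
  (w : T → ℚ) → (∀ t → 0ℚ ≤ w t) → IsPositiveLinear (weighted S w)
weighted-positive P w 0≤w = record
  { isLinear    = record
    { ext         = λ f≗g → ext (λ t → cong (w t *_) (f≗g t))
    ; additive    = λ f g → trans (ext (λ t → *-distribˡ-+ (w t) _ _)) (additive _ _)
    ; homogeneous = λ c f → trans (ext (λ t → *-left-commute (w t) c (f t))) (homogeneous c _)
    }
  ; monotone    = λ f≤g → monotone (λ t → *-monoˡ-≤-nonNeg (w t) {{nonNegative (0≤w t)}} (f≤g t))
  ; interchange = λ S′ S′-linear f →
      trans (interchange S′ S′-linear _) (ext (λ t → IsLinear.homogeneous S′-linear (w t) (f t)))
  }
  where
  open IsPositiveLinear P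
  *-left-commute : ∀ a b c → a * (b * c) ≡ b * (a * c)
  *-left-commute = solve 3 (λ a b c → a :* (b :* c) := b :* (a :* c)) refl

weighted-normalised : {T : Set} {S : Functional T} → IsLinear S →
  (w : T → ℚ) → S w ≡ 1ℚ → Normalised (weighted S w)
weighted-normalised L w Sw≡1 c =
  trans (ext (λ t → *-comm (w t) c)) (trans (homogeneous c w) (trans (cong (c *_) Sw≡1) (*-identityʳ c)))
  where open IsLinear L

sumVec-positive : ∀ m R → IsPositiveLinear (sumVec m R)
sumVec-positive m zero    = nilᶠ-positive
sumVec-positive m (suc R) = ∷ᶠ-positive (sumFin-positive m) (sumVec-positive m R)

module _ {m : ℕ} where

  NonNegativeDist : Dist m → Set
  NonNegativeDist μ = ∀ a → 0ℚ ≤ μ a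

  NonNegativeKernel : Kernel m → Set
  NonNegativeKernel K = ∀ a b → 0ℚ ≤ K a b

  Stochastic : Kernel m → Set
  Stochastic K = ∀ a → sumFin m (K a) ≡ 1ℚ

  prodDist-nonneg : ∀ {μ} → NonNegativeDist μ → ∀ {R} (A : Vec (Fin m) R) → 0ℚ ≤ prodDist μ A
  prodDist-nonneg 0≤μ []      = nonNegative⁻¹ 1ℚ
  prodDist-nonneg 0≤μ (a ∷ A) = 0≤*-nonneg (0≤μ a) (prodDist-nonneg 0≤μ A)

  prodKernel-nonneg : ∀ {K} → NonNegativeKernel K → ∀ {R} (A B : Vec (Fin m) R) → 0ℚ ≤ prodKernel K A B
  prodKernel-nonneg 0≤K []      []      = nonNegative⁻¹ 1ℚ
  prodKernel-nonneg 0≤K (a ∷ A) (b ∷ B) = 0≤*-nonneg (0≤K a b) (prodKernel-nonneg 0≤K A B)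

  prodKernel-stochastic : ∀ {K} → Stochastic K → ∀ {R} (A : Vec (Fin m) R) → sumVec m R (prodKernel K A) ≡ 1ℚ
  prodKernel-stochastic K-stoch []               = refl
  prodKernel-stochastic {K} K-stoch {suc R} (a ∷ A) = begin
    sumFin m (λ b → sumVec m R (λ B → K a b * prodKernel K A B))  ≡⟨ ext (λ b → homogeneous (K a b) _) ⟩
    sumFin m (λ b → K a b * sumVec m R (prodKernel K A))          ≡⟨ ext (λ b → cong (K a b *_) (prodKernel-stochastic K-stoch A)) ⟩
    sumFin m (λ b → K a b * 1ℚ)                                    ≡⟨ ext (λ b → *-identityʳ (K a b)) ⟩
    sumFin m (K a)                                                 ≡⟨ K-stoch a ⟩
    1ℚ                                                             ∎
    where
    open ≡-Reasoning
    open IsPositiveLinear (sumFin-positive m) using (ext)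
    open IsPositiveLinear (sumVec-positive m R) using (homogeneous)

  E-prod-positive : ∀ R {μ} → NonNegativeDist μ → IsPositiveLinear (E-prod m R μ)
  E-prod-positive R {μ} 0≤μ = weighted-positive (sumVec-positive m R) (prodDist μ) (prodDist-nonneg 0≤μ)

  module _ {R : ℕ} {K : Kernel m} (A : Vec (Fin m) R) where

    E-step-positive : NonNegativeKernel K → IsPositiveLinear (E-step m R K A)
    E-step-positive 0≤K = weighted-positive (sumVec-positive m R) (prodKernel K A) (prodKernel-nonneg 0≤K A)

    E-step-normalised : Stochastic K → Normalised (E-step m R K A)
    E-step-normalised K-stoch =
      weighted-normalised (IsPositiveLinear.isLinear (sumVec-positive m R)) (prodKernel K A) (prodKernel-stochastic K-stoch A)

    E-steps-positive : NonNegativeKernel K → ∀ d → IsPositiveLinear (E-steps m R d K A)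
    E-steps-positive 0≤K zero    = nilᶠ-positive
    E-steps-positive 0≤K (suc d) = ∷ᶠ-positive (E-step-positive 0≤K) (E-steps-positive 0≤K d)

    E-steps-normalised : NonNegativeKernel K → Stochastic K → ∀ d → Normalised (E-steps m R d K A)
    E-steps-normalised 0≤K K-stoch zero    c = refl
    E-steps-normalised 0≤K K-stoch (suc d) =
      ∷ᶠ-normalised {S₂ = E-steps m R d K A} (IsPositiveLinear.isLinear (E-step-positive 0≤K))
                    (E-step-normalised K-stoch) (E-steps-normalised 0≤K K-stoch d)

module _ {m R : ℕ} {K : Kernel m} (0≤K : NonNegativeKernel K) (K-stoch : Stochastic K)
         (A : Vec (Fin m) R) {Y : Set} (F : Vec (Fin m) R → Y → ℚ) where

  private
    S : Functional (Vec (Fin m) R)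
    S = E-step m R K A

    P : IsPositiveLinear S
    P = E-step-positive A 0≤K

    N : Normalised S
    N = E-step-normalised A K-stoch

    open IsPositiveLinear P using (monotone)

    gap : ∀ {d} → Y → Vec Y d → Vec (Fin m) R → Vec (Vec (Fin m) R) d → ℚ
    gap x ys b cs = maxVec (zipWith (λ c y → ∣ F b x - F c y ∣) cs ys)

  ∣difference∣≤average : ∀ x y →
    ∣ S (λ b → F b x) - S (λ c → F c y) ∣ ≤ S (λ b → S (λ c → ∣ F b x - F c y ∣))
  ∣difference∣≤average x y = begin
    ∣ S (λ b → F b x) - S (λ c → F c y) ∣      ≡⟨ cong ∣_∣ (difference-as-average P N F x y) ⟩
    ∣ S (λ b → S (λ c → F b x - F c y)) ∣      ≤⟨ ∣∣-jensen P N _ ⟩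
    S (λ b → ∣ S (λ c → F b x - F c y) ∣)      ≤⟨ monotone (λ b → ∣∣-jensen P N _) ⟩
    S (λ b → S (λ c → ∣ F b x - F c y ∣))      ∎
    where open ≤-Reasoning

  max∣difference∣≤average : ∀ x {d} (ys : Vec Y d) →
    maxVec (map (λ y → ∣ S (λ b → F b x) - S (λ c → F c y) ∣) ys)
      ≤ S (λ b → E-steps m R d K A (gap x ys b))
  max∣difference∣≤average x []               = const≤ P N (λ _ → ≤-refl)
  max∣difference∣≤average x {suc d} (y ∷ ys) = ⊔-lub head-bound tail-bound
    where
    Sᵈ-positive : IsPositiveLinear (E-steps m R d K A)
    Sᵈ-positive = E-steps-positive A 0≤K d

    Sᵈ-normalised : Normalised (E-steps m R d K A)
    Sᵈ-normalised = E-steps-normalised A 0≤K K-stoch d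

    open IsPositiveLinear Sᵈ-positive renaming (monotone to Sᵈ-monotone)

    head-bound : ∣ S (λ b → F b x) - S (λ c → F c y) ∣ ≤ S (λ b → E-steps m R (suc d) K A (gap x (y ∷ ys) b))
    head-bound = ≤-trans (∣difference∣≤average x y)
      (monotone (λ b → monotone (λ c → const≤ Sᵈ-positive Sᵈ-normalised (λ cs → p≤p⊔q _ (gap x ys b cs)))))

    tail-bound : maxVec (map (λ y → ∣ S (λ b → F b x) - S (λ c → F c y) ∣) ys)
                   ≤ S (λ b → E-steps m R (suc d) K A (gap x (y ∷ ys) b))
    tail-bound = ≤-trans (max∣difference∣≤average x ys)
      (monotone (λ b → const≤ P N (λ c → Sᵈ-monotone (λ cs → p≤q⊔p ∣ F b x - F c y ∣ (gap x ys b cs)))))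

  averaged-max∣difference∣≤average : ∀ {d} {Eˣ : Functional Y} {Eʸ : Y → Functional (Vec Y d)} →
    IsPositiveLinear Eˣ → (∀ x → IsPositiveLinear (Eʸ x)) →
    Eˣ (λ x → Eʸ x (λ ys → maxVec (map (λ y → ∣ S (λ b → F b x) - S (λ c → F c y) ∣) ys)))
      ≤ S (λ b → E-steps m R d K A (λ cs → Eˣ (λ x → Eʸ x (λ ys → gap x ys b cs))))
  averaged-max∣difference∣≤average {d} {Eˣ} {Eʸ} Pˣ Pʸ = begin
    Eˣ (λ x → Eʸ x (λ ys → maxVec (map (λ y → ∣ S (λ b → F b x) - S (λ c → F c y) ∣) ys)))
      ≤⟨ Pˣ.monotone (λ x → Pʸ.monotone x (max∣difference∣≤average x)) ⟩
    Eˣ (λ x → Eʸ x (λ ys → S (λ b → Sᵈ (gap x ys b))))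
      ≡⟨ Pˣ.ext (λ x → interchange₂ {P = Eʸ x} {S = S} (Pʸ.interchange x) L Lᵈ (λ ys → gap x ys)) ⟩
    Eˣ (λ x → S (λ b → Sᵈ (λ cs → Eʸ x (λ ys → gap x ys b cs))))
      ≡⟨ interchange₂ {P = Eˣ} {S = S} Pˣ.interchange L Lᵈ (λ x b cs → Eʸ x (λ ys → gap x ys b cs)) ⟩
    S (λ b → Sᵈ (λ cs → Eˣ (λ x → Eʸ x (λ ys → gap x ys b cs))))
      ∎
    where
    open ≤-Reasoning
    module Pˣ = IsPositiveLinear Pˣ
    module Pʸ x = IsPositiveLinear (Pʸ x)
    Sᵈ : Functional (Vec (Vec (Fin m) R) d)
    Sᵈ = E-steps m R d K A
    L : IsLinear S
    L = IsPositiveLinear.isLinear P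
    Lᵈ : IsLinear Sᵈ
    Lᵈ = IsPositiveLinear.isLinear (E-steps-positive A 0≤K d)

ℕ→ℚ-suc : ∀ c → ℕ→ℚ (suc c) ≡ 1ℚ + ℕ→ℚ c
ℕ→ℚ-suc c = toℚᵘ-injective (begin
  toℚᵘ (ℕ→ℚ (suc c))                          ≈⟨ toℚᵘ-fromℚᵘ (ℚᵘ.mkℚᵘ (+ suc c) 0) ⟩
  ℚᵘ.mkℚᵘ (+ suc c) 0                          ≈⟨ ℚᵘ.≃-sym one-plus ⟩
  ℚᵘ.mkℚᵘ (+ 1) 0 ℚᵘ.+ ℚᵘ.mkℚᵘ (+ c) 0        ≈⟨ ℚᵘ.+-cong (ℚᵘ.≃-sym (toℚᵘ-fromℚᵘ (ℚᵘ.mkℚᵘ (+ 1) 0))) (ℚᵘ.≃-sym (toℚᵘ-fromℚᵘ (ℚᵘ.mkℚᵘ (+ c) 0))) ⟩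
  toℚᵘ 1ℚ ℚᵘ.+ toℚᵘ (ℕ→ℚ c)                   ≈⟨ ℚᵘ.≃-sym (toℚᵘ-homo-+ 1ℚ (ℕ→ℚ c)) ⟩
  toℚᵘ (1ℚ + ℕ→ℚ c)                            ∎)
  where
  open ℚᵘ.≃-Reasoning
  one-plus : ℚᵘ.mkℚᵘ (+ 1) 0 ℚᵘ.+ ℚᵘ.mkℚᵘ (+ c) 0 ℚᵘ.≃ ℚᵘ.mkℚᵘ (+ suc c) 0
  one-plus rewrite ℕ.*-identityʳ c | ℤ.+◃n≡+n c = ℚᵘ.*≡* refl

0≤ℕ→ℚ : ∀ c → 0ℚ ≤ ℕ→ℚ c
0≤ℕ→ℚ c = nonNegative⁻¹ _ {{normalize-nonNeg c 1}}

0<ℕ→ℚ-suc : ∀ c → 0ℚ < ℕ→ℚ (suc c)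
0<ℕ→ℚ-suc c = positive⁻¹ _ {{normalize-pos (suc c) 1}}

p≤p+q : ∀ {p q} → 0ℚ ≤ q → p ≤ p + q
p≤p+q {p} {q} 0≤q = subst (_≤ p + q) (+-identityʳ p) (+-monoʳ-≤ p 0≤q)

1≤ℕ→ℚ-suc : ∀ c → 1ℚ ≤ ℕ→ℚ (suc c)
1≤ℕ→ℚ-suc c = subst (1ℚ ≤_) (sym (ℕ→ℚ-suc c)) (p≤p+q (0≤ℕ→ℚ c))

0≤q-p : ∀ {p q} → p ≤ q → 0ℚ ≤ q - p
0≤q-p {p} {q} p≤q = subst (_≤ q - p) (+-inverseʳ p) (+-monoˡ-≤ (- p) p≤q)

sumFin-const : ∀ m c → sumFin m (λ _ → c) ≡ ℕ→ℚ m * c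
sumFin-const zero    c = sym (*-zeroˡ c)
sumFin-const (suc m) c = begin
  c + sumFin m (λ _ → c)     ≡⟨ cong (_+_ c) (sumFin-const m c) ⟩
  c + ℕ→ℚ m * c             ≡⟨ cong (_+ ℕ→ℚ m * c) (sym (*-identityˡ c)) ⟩
  1ℚ * c + ℕ→ℚ m * c        ≡⟨ sym (*-distribʳ-+ c 1ℚ (ℕ→ℚ m)) ⟩
  (1ℚ + ℕ→ℚ m) * c          ≡⟨ cong (_* c) (sym (ℕ→ℚ-suc m)) ⟩
  ℕ→ℚ (suc m) * c           ∎
  where open ≡-Reasoning

sumFin-bool→ℚ : ∀ m (p : Fin m → Bool) → sumFin m (λ a → bool→ℚ (p a)) ≡ ℕ→ℚ (countFin m p)
sumFin-bool→ℚ zero    p = refl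
sumFin-bool→ℚ (suc m) p with p zero
... | true  = trans (cong (_+_ 1ℚ) (sumFin-bool→ℚ m (λ i → p (suc i)))) (sym (ℕ→ℚ-suc (countFin m (λ i → p (suc i)))))
... | false = trans (+-identityˡ _) (sumFin-bool→ℚ m (λ i → p (suc i)))

0≤1/q : ∀ q .{{_ : NonZero q}} → 0ℚ ≤ q → 0ℚ ≤ 1/ q
0≤1/q q 0≤q = <⇒≤ (positive⁻¹ _ {{1/pos⇒pos q {{nonNeg∧nonZero⇒pos q {{nonNegative 0≤q}}}}}})

÷?-nonneg : ∀ {p q} → 0ℚ ≤ p → 0ℚ ≤ q → 0ℚ ≤ p ÷? q
÷?-nonneg {p} {q} 0≤p 0≤q with q ≟ 0ℚ
... | yes _   = ≤-refl
... | no q≢0 = 0≤*-nonneg 0≤p (0≤1/q q {{≢-nonZero q≢0}} 0≤q)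

÷?-≤1 : ∀ {p q} → p ≤ q → 0ℚ ≤ q → p ÷? q ≤ 1ℚ
÷?-≤1 {p} {q} p≤q 0≤q with q ≟ 0ℚ
... | yes _   = nonNegative⁻¹ 1ℚ
... | no q≢0 = ≤-trans (*-monoʳ-≤-nonNeg (1/ q) {{nonNegative (0≤1/q q 0≤q)}} p≤q) (≤-reflexive (*-inverseʳ q))
  where instance _ = ≢-nonZero q≢0

÷?≡1÷?* : ∀ p q → p ÷? q ≡ (1ℚ ÷? q) * p
÷?≡1÷?* p q with q ≟ 0ℚ
... | yes _   = sym (*-zeroˡ p)
... | no q≢0 = trans (*-comm p _) (cong (_* p) (sym (*-identityˡ (1/ q))))
  where instance _ = ≢-nonZero q≢0

*1÷?-inverse : ∀ q → 0ℚ < q → q * (1ℚ ÷? q) ≡ 1ℚ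
*1÷?-inverse q 0<q with q ≟ 0ℚ
... | yes q≡0 = ⊥-elim (<-irrefl (sym q≡0) 0<q)
... | no q≢0 = trans (cong (q *_) (*-identityˡ _)) (*-inverseʳ q)
  where instance _ = ≢-nonZero q≢0

uniform-nonneg : ∀ n → NonNegativeDist (uniform n)
uniform-nonneg n _ = ÷?-nonneg (nonNegative⁻¹ 1ℚ) (0≤ℕ→ℚ n)

sumFin-uniform : ∀ {n} → Fin n → sumFin n (uniform n) ≡ 1ℚ
sumFin-uniform {suc n} _ = trans (sumFin-const (suc n) _) (*1÷?-inverse _ (0<ℕ→ℚ-suc n))

module _ {ε : ℚ} (0≤ε : 0ℚ ≤ ε) (ε≤⅓ : ε ≤ + 1 / 3) where

  private
    ε≤1-2ε : ε ≤ 1ℚ - ℕ→ℚ 2 * ε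
    ε≤1-2ε = subst (ε ≤_) (sym (rearrange ε)) (p≤p+q (0≤q-p (*-monoˡ-≤-nonNeg (ℕ→ℚ 3) ε≤⅓)))
      where
      rearrange : ∀ e → 1ℚ - ℕ→ℚ 2 * e ≡ e + (1ℚ - ℕ→ℚ 3 * e)
      rearrange = solve 1 (λ e → con 1ℚ :- con (ℕ→ℚ 2) :* e := e :+ (con 1ℚ :- con (ℕ→ℚ 3) :* e)) refl

    0≤r : 0ℚ ≤ ε ÷? (1ℚ - ℕ→ℚ 2 * ε)
    0≤r = ÷?-nonneg 0≤ε (≤-trans 0≤ε ε≤1-2ε)

    0≤1-r : 0ℚ ≤ 1ℚ - ε ÷? (1ℚ - ℕ→ℚ 2 * ε)
    0≤1-r = 0≤q-p (÷?-≤1 ε≤1-2ε (≤-trans 0≤ε ε≤1-2ε))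

    0≤½ : 0ℚ ≤ half
    0≤½ = nonNegative⁻¹ half

    0≤½-ε : 0ℚ ≤ half - ε
    0≤½-ε = 0≤q-p (≤-trans ε≤⅓ (toWitness {a? = + 1 / 3 ≤? half} tt))

  μH-nonneg : NonNegativeDist (μH ε)
  μH-nonneg zero                   = 0≤½-ε
  μH-nonneg (suc zero)             = 0≤ε
  μH-nonneg (suc (suc zero))       = 0≤ε
  μH-nonneg (suc (suc (suc zero))) = 0≤½-ε

  H-nonneg : NonNegativeKernel (H ε)
  H-nonneg zero                   zero                   = 0≤1-r
  H-nonneg zero                   (suc zero)             = 0≤r
  H-nonneg zero                   (suc (suc _))          = ≤-refl
  H-nonneg (suc zero)             zero                   = 0≤½
  H-nonneg (suc zero)             (suc zero)             = ≤-refl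
  H-nonneg (suc zero)             (suc (suc zero))       = 0≤½
  H-nonneg (suc zero)             (suc (suc (suc _)))    = ≤-refl
  H-nonneg (suc (suc zero))       zero                   = ≤-refl
  H-nonneg (suc (suc zero))       (suc zero)             = 0≤½
  H-nonneg (suc (suc zero))       (suc (suc zero))       = ≤-refl
  H-nonneg (suc (suc zero))       (suc (suc (suc zero))) = 0≤½
  H-nonneg (suc (suc (suc zero))) zero                   = ≤-refl
  H-nonneg (suc (suc (suc zero))) (suc zero)             = ≤-refl
  H-nonneg (suc (suc (suc zero))) (suc (suc zero))       = 0≤r
  H-nonneg (suc (suc (suc zero))) (suc (suc (suc zero))) = 0≤1-r

0≤etaOf : ∀ {ε} → 0ℚ ≤ ε → ∀ d → 0ℚ ≤ etaOf ε d
0≤etaOf 0≤ε d = ÷?-nonneg 0≤ε (0≤ℕ→ℚ (100 ℕ.* d))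

etaOf≤1 : ∀ {ε} → ε ≤ 1ℚ → ∀ d → etaOf ε (suc d) ≤ 1ℚ
etaOf≤1 ε≤1 d = ÷?-≤1 (≤-trans ε≤1 (1≤ℕ→ℚ-suc (d ℕ.+ 99 ℕ.* suc d))) (0≤ℕ→ℚ (100 ℕ.* suc d))

Gη-nonneg : ∀ {n k adj η} → 0ℚ ≤ η → η ≤ 1ℚ → NonNegativeKernel (Gη n k adj η)
Gη-nonneg {n} {k} {adj} 0≤η η≤1 a b =
  +-mono-≤ (0≤*-nonneg (0≤q-p η≤1) (÷?-nonneg (0≤bool→ℚ (adj a b)) (0≤ℕ→ℚ k)))
           (0≤*-nonneg 0≤η (uniform-nonneg n b))
  where
  0≤bool→ℚ : ∀ b → 0ℚ ≤ bool→ℚ b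
  0≤bool→ℚ true  = nonNegative⁻¹ 1ℚ
  0≤bool→ℚ false = ≤-refl

Gη-stochastic : ∀ {n k adj} η → IsRegularGraph n (suc k) adj → Stochastic (Gη n (suc k) adj η)
Gη-stochastic {n} {k} {adj} η regular-graph a = begin
  sumFin n (λ b → (1ℚ - η) * (bool→ℚ (adj a b) ÷? deg) + η * uniform n b)
    ≡⟨ additive _ _ ⟩
  sumFin n (λ b → (1ℚ - η) * (bool→ℚ (adj a b) ÷? deg)) + sumFin n (λ b → η * uniform n b)
    ≡⟨ cong₂ _+_ (homogeneous (1ℚ - η) _) (homogeneous η _) ⟩
  (1ℚ - η) * sumFin n (λ b → bool→ℚ (adj a b) ÷? deg) + η * sumFin n (uniform n)
    ≡⟨ cong₂ (λ u v → (1ℚ - η) * u + η * v) neighbours (sumFin-uniform a) ⟩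
  (1ℚ - η) * 1ℚ + η * 1ℚ
    ≡⟨ solve 1 (λ h → (con 1ℚ :- h) :* con 1ℚ :+ h :* con 1ℚ := con 1ℚ) refl η ⟩
  1ℚ ∎
  where
  open ≡-Reasoning
  open IsPositiveLinear (sumFin-positive n)
  open IsRegularGraph regular-graph using (regular)
  deg : ℚ
  deg = ℕ→ℚ (suc k)

  neighbours : sumFin n (λ b → bool→ℚ (adj a b) ÷? deg) ≡ 1ℚ
  neighbours = begin
    sumFin n (λ b → bool→ℚ (adj a b) ÷? deg)         ≡⟨ ext (λ b → ÷?≡1÷?* (bool→ℚ (adj a b)) deg) ⟩
    sumFin n (λ b → (1ℚ ÷? deg) * bool→ℚ (adj a b))  ≡⟨ homogeneous (1ℚ ÷? deg) _ ⟩
    (1ℚ ÷? deg) * sumFin n (λ b → bool→ℚ (adj a b))  ≡⟨ cong (_*_ (1ℚ ÷? deg)) (sumFin-bool→ℚ n (adj a)) ⟩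
    (1ℚ ÷? deg) * ℕ→ℚ (degree n adj a)               ≡⟨ cong (λ c → (1ℚ ÷? deg) * ℕ→ℚ c) (regular a) ⟩
    (1ℚ ÷? deg) * deg                                ≡⟨ *-comm (1ℚ ÷? deg) deg ⟩
    deg * (1ℚ ÷? deg)                                ≡⟨ *1÷?-inverse deg (0<ℕ→ℚ-suc k) ⟩
    1ℚ                                               ∎

lemma6p2 : (n k : ℕ) (adj : Fin n → Fin n → Bool) → IsRegularGraph n k adj → k ≥ 1 →
           (ε : ℚ) → 0ℚ < ε → ε ≤ + 1 / 3 →
           (d R : ℕ) → d ≥ 1 → R ≥ 1 →
           (F' : Multiset n → Bool) →
           let open Setting n k adj ε d R in
           E-prod n R (uniform n) (λ A → valμH (gA F' A)) ≤ valP' F'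
lemma6p2 n zero    adj _ () ε _ _ d R _ _ F'
lemma6p2 n (suc k) adj _ _ ε _ _ zero R () _ F'
lemma6p2 n (suc k) adj regular-graph _ ε 0<ε ε≤⅓ (suc d) R _ _ F' =
  IsPositiveLinear.monotone (E-prod-positive R (uniform-nonneg n)) λ A →
    averaged-max∣difference∣≤average 0≤G (Gη-stochastic η regular-graph) A (Fof F')
      (E-prod-positive R (μH-nonneg 0≤ε ε≤⅓)) (λ x → E-steps-positive x (H-nonneg 0≤ε ε≤⅓) (suc d))
  where
  open Setting n (suc k) adj ε (suc d) R

  0≤ε : 0ℚ ≤ ε
  0≤ε = <⇒≤ 0<ε

  0≤G : NonNegativeKernel G
  0≤G = Gη-nonneg {n} {suc k} {adj} (0≤etaOf 0≤ε (suc d)) (etaOf≤1 ε≤1 d)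
    where
    ε≤1 : ε ≤ 1ℚ
    ε≤1 = ≤-trans ε≤⅓ (toWitness {a? = + 1 / 3 ≤? 1ℚ} tt)
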